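{- Let $\Gamma_0$ be a directed Eulerian multi-triangulation of a connected closed surface $M$ whose underlying graph is $3$-colorable, and fix a proper $3$-coloring of the underlying graph. Then: (1) if there is a directed walk of length $m$ in $\Gamma_0$ from a vertex $v$ to a vertex $w$, then $v$ and $w$ have the same color if and only if $m$ is divisible by $3$; (2) every closed directed walk in $\Gamma_0$ has length divisible by $3$.
   Context: Digraphs are finite, without loops, possibly with multiple directed edges. An Eulerian digraph is a connected digraph in which every vertex has equal indegree and outdegree. A directed Eulerian embedding is a $2$-cell embedding of an Eulerian digraph in a connected closed $2$-dimensional surface $M$ (not necessarily orientable) such that the boundary of each face is a directed closed walk. A multi-triangulation is a closed $2$-cell embedding of a connected finite graph (multiple edges allowed) in which every face is homeomorphic to a closed disk and is a triangle. A directed Eulerian multi-triangulation is a directed Eulerian embedding whose underlying graph is a multi-triangulation. The length of a walk counts edges with multiplicity. -}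

module Defs where

open import Data.Nat using (ℕ; zero; suc)
open import Data.Fin using (Fin; zero; suc)
open import Data.Product using (_×_; _,_; proj₁; proj₂; ∃)
open import Data.Sum using (_⊎_)
open import Relation.Binary.PropositionalEquality using (_≡_; _≢_)
open import Relation.Binary.Construct.Closure.ReflexiveTransitive using (Star)

next : Fin 3 → Fin 3
next zero = suc zero
next (suc zero) = suc (suc zero)
next (suc (suc zero)) = zero

prev : Fin 3 → Fin 3
prev zero = suc (suc zero)
prev (suc zero) = zero
prev (suc (suc zero)) = suc zero

Side : ℕ → Set
Side nF = Fin nF × Fin 3

-- Combinatorial model of a directed Eulerian multi-triangulation Γ₀ of a
-- connected closed surface M (orientable or not), with vertex set Fin nV
-- and face set Fin nF.
-- M is obtained from the nF triangular faces by gluing their sides in pairs.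
-- The side (f , i) of face f is the directed edge from corner i to corner
-- (next i) of f, so the boundary of every face is a directed closed walk of
-- length 3.  Corner (f , i) carries the vertex vert (f , i).
-- σ pairs the sides that are glued; each glued pair {s , σ s} is one
-- (directed) edge of Γ₀, and gluing respects directions.
-- head / tail of a side, given the corner labelling
module _ {nV nF : ℕ} (vert : Side nF → Fin nV) (σ : Side nF → Side nF) where
  tailOf headOf : Side nF → Fin nV
  tailOf s = vert s
  headOf s = vert (proj₁ s , next (proj₂ s))

  inSide : Side nF → Side nF
  inSide c = (proj₁ c , prev (proj₂ c))

  -- two corners are adjacent in the link of their common vertex if their
  -- outgoing sides are glued or their incoming sides are glued
  LinkAdj : Side nF → Side nF → Set
  LinkAdj c c' = (σ c ≡ c') ⊎ (σ (inSide c) ≡ inSide c')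

  FaceAdj : Fin nF → Fin nF → Set
  FaceAdj f g = ∃ λ i → ∃ λ j → σ (f , i) ≡ (g , j)

record DirEulerMultiTriangulation (nV nF : ℕ) : Set where
  field
    vert    : Side nF → Fin nV
    σ       : Side nF → Side nF
    σ-invol : ∀ s → σ (σ s) ≡ s
    σ-nofix : ∀ s → σ s ≢ s
    σ-tail  : ∀ s → tailOf vert σ (σ s) ≡ tailOf vert σ s
    σ-head  : ∀ s → headOf vert σ (σ s) ≡ headOf vert σ s
    -- each face is a closed disk bounded by a triangle: its three corners
    -- are distinct vertices (in particular no loops)
    face-distinct : ∀ f i → vert (f , i) ≢ vert (f , next i)
    vert-surj : ∀ v → ∃ λ c → vert c ≡ v
    -- vertices are exactly the points produced by the gluing, and the link
    -- of every vertex is a single cycle (so M is a closed surface)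
    vertex-link : ∀ c c' → vert c ≡ vert c' → Star (LinkAdj vert σ) c c'
    connected : ∀ f g → Star (FaceAdj vert σ) f g

  tail head : Side nF → Fin nV
  tail = tailOf vert σ
  head = headOf vert σ

  -- directed walks of length m from v to w (each edge given by a side
  -- representing it)
  data Walk : Fin nV → Fin nV → ℕ → Set where
    []  : ∀ {v} → Walk v v 0
    _∷_ : ∀ {w m} (s : Side nF) → Walk (head s) w m → Walk (tail s) w (suc m)

  ProperColouring : (Fin nV → Fin 3) → Set
  ProperColouring col = ∀ s → col (tail s) ≢ col (head s)

-- In a properly 3-coloured triangle the colours of the corners are pairwise
-- distinct, so walking once around the directed boundary either advances every
-- colour by one step of the cyclic order on the colours or moves every colour
-- back by one step.  Two faces glued along a side induce the same direction on
-- it, hence turn the same way, and since the surface is connected all faces do.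
-- So along every directed edge the colour moves by the same rotation ρ of order
-- three without fixed points, and a walk of length m moves it by ρᵐ, which is
-- the identity exactly when 3 ∣ m.
module Submission where

open import Defs
open import Data.Nat using (ℕ; zero; suc; _*_)
open import Data.Fin using (Fin; zero; suc)
open import Data.Nat.Divisibility using (_∣_; divides-refl; ∣m∣n⇒∣m+n; n∣n)
open import Data.Product using (_×_; _,_; ∃)
open import Data.Sum using (_⊎_; inj₁; inj₂)
open import Function.Base using (id; _∘_)
open import Function.Bundles using (_⇔_; mk⇔; Equivalence)
open import Relation.Nullary using (contradiction)
open import Relation.Binary.PropositionalEquality
open import Relation.Binary.Construct.Closure.ReflexiveTransitive using (fold)

data Rotation : Set where
  forward backward : Rotation

rotate : Rotation → Fin 3 → Fin 3
rotate forward  = next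
rotate backward = prev

rotate-cube : ∀ r x → rotate r (rotate r (rotate r x)) ≡ x
rotate-cube forward  zero             = refl
rotate-cube forward  (suc zero)       = refl
rotate-cube forward  (suc (suc zero)) = refl
rotate-cube backward zero             = refl
rotate-cube backward (suc zero)       = refl
rotate-cube backward (suc (suc zero)) = refl

rotate-fixfree : ∀ r x → rotate r x ≢ x
rotate-fixfree forward  zero             ()
rotate-fixfree forward  (suc zero)       ()
rotate-fixfree forward  (suc (suc zero)) ()
rotate-fixfree backward zero             ()
rotate-fixfree backward (suc zero)       ()
rotate-fixfree backward (suc (suc zero)) ()

rotate-orbit : ∀ r a c → c ≡ a ⊎ c ≡ rotate r a ⊎ c ≡ rotate r (rotate r a)
rotate-orbit forward  zero             zero             = inj₁ refl
rotate-orbit forward  zero             (suc zero)       = inj₂ (inj₁ refl)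
rotate-orbit forward  zero             (suc (suc zero)) = inj₂ (inj₂ refl)
rotate-orbit forward  (suc zero)       zero             = inj₂ (inj₂ refl)
rotate-orbit forward  (suc zero)       (suc zero)       = inj₁ refl
rotate-orbit forward  (suc zero)       (suc (suc zero)) = inj₂ (inj₁ refl)
rotate-orbit forward  (suc (suc zero)) zero             = inj₂ (inj₁ refl)
rotate-orbit forward  (suc (suc zero)) (suc zero)       = inj₂ (inj₂ refl)
rotate-orbit forward  (suc (suc zero)) (suc (suc zero)) = inj₁ refl
rotate-orbit backward zero             zero             = inj₁ refl
rotate-orbit backward zero             (suc zero)       = inj₂ (inj₂ refl)
rotate-orbit backward zero             (suc (suc zero)) = inj₂ (inj₁ refl)
rotate-orbit backward (suc zero)       zero             = inj₂ (inj₁ refl)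
rotate-orbit backward (suc zero)       (suc zero)       = inj₁ refl
rotate-orbit backward (suc zero)       (suc (suc zero)) = inj₂ (inj₂ refl)
rotate-orbit backward (suc (suc zero)) zero             = inj₂ (inj₂ refl)
rotate-orbit backward (suc (suc zero)) (suc zero)       = inj₂ (inj₁ refl)
rotate-orbit backward (suc (suc zero)) (suc (suc zero)) = inj₁ refl

rotate-third : ∀ r a c → c ≢ a → c ≢ rotate r a → c ≡ rotate r (rotate r a)
rotate-third r a c c≢a c≢ra with rotate-orbit r a c
... | inj₁ c≡a          = contradiction c≡a c≢a
... | inj₂ (inj₁ c≡ra)  = contradiction c≡ra c≢ra
... | inj₂ (inj₂ c≡rra) = c≡rra

rotation-between : ∀ {a b} → a ≢ b → ∃ λ r → b ≡ rotate r a
rotation-between {a} {b} a≢b with rotate-orbit forward a b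
... | inj₁ b≡a          = contradiction (sym b≡a) a≢b
... | inj₂ (inj₁ b≡na)  = forward , b≡na
... | inj₂ (inj₂ b≡nna) = backward , trans b≡nna (next∘next≡prev a)
  where
  next∘next≡prev : ∀ x → next (next x) ≡ prev x
  next∘next≡prev zero             = refl
  next∘next≡prev (suc zero)       = refl
  next∘next≡prev (suc (suc zero)) = refl

rotateⁿ : Rotation → ℕ → Fin 3 → Fin 3
rotateⁿ r zero    x = x
rotateⁿ r (suc m) x = rotateⁿ r m (rotate r x)

rotateⁿ-fixes⇒3∣ : ∀ r m x → rotateⁿ r m x ≡ x → 3 ∣ m
rotateⁿ-fixes⇒3∣ r zero                x _ = divides-refl 0
rotateⁿ-fixes⇒3∣ r (suc zero)          x e = contradiction e (rotate-fixfree r x)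
rotateⁿ-fixes⇒3∣ r (suc (suc zero))    x e =
  contradiction (trans (sym (cong (rotate r) e)) (rotate-cube r x)) (rotate-fixfree r x)
rotateⁿ-fixes⇒3∣ r (suc (suc (suc m))) x e = ∣m∣n⇒∣m+n n∣n
  (rotateⁿ-fixes⇒3∣ r m x (trans (cong (rotateⁿ r m) (sym (rotate-cube r x))) e))

3∣⇒rotateⁿ-fixes : ∀ r m x → 3 ∣ m → rotateⁿ r m x ≡ x
3∣⇒rotateⁿ-fixes r _ x (divides-refl q) = go q
  where
  go : ∀ q → rotateⁿ r (q * 3) x ≡ x
  go zero    = refl
  go (suc q) = trans (cong (rotateⁿ r (q * 3)) (rotate-cube r x)) (go q)

rotateⁿ-fixes⇔3∣ : ∀ r m x → (rotateⁿ r m x ≡ x) ⇔ (3 ∣ m)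
rotateⁿ-fixes⇔3∣ r m x = mk⇔ (rotateⁿ-fixes⇒3∣ r m x) (3∣⇒rotateⁿ-fixes r m x)

module _ {nV nF} (Γ₀ : DirEulerMultiTriangulation nV nF) (col : Fin nV → Fin 3)
         (proper : DirEulerMultiTriangulation.ProperColouring Γ₀ col) where
  open DirEulerMultiTriangulation Γ₀

  Shifts : Rotation → Side nF → Set
  Shifts r s = col (head s) ≡ rotate r (col (tail s))

  FaceShifts : Rotation → Fin nF → Set
  FaceShifts r f = ∀ i → Shifts r (f , i)

  shifts-next-side : ∀ r {f i} → Shifts r (f , i) → Shifts r (f , next i)
  shifts-next-side r {f} {i} shifts =
    trans (rotate-third r a c c≢a c≢ra) (cong (rotate r) (sym shifts))
    where
    a c : Fin 3
    a = col (vert (f , i))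
    c = col (vert (f , next (next i)))
    c≢a : c ≢ a
    c≢a = subst (λ j → c ≢ col (vert (f , j))) (rotate-cube forward i) (proper (f , next (next i)))
    c≢ra : c ≢ rotate r a
    c≢ra = subst (c ≢_) shifts (proper (f , next i) ∘ sym)

  shifts-face : ∀ r {f j} → Shifts r (f , j) → FaceShifts r f
  shifts-face r {j = j} shifts i with rotate-orbit forward j i
  ... | inj₁ refl        = shifts
  ... | inj₂ (inj₁ refl) = shifts-next-side r shifts
  ... | inj₂ (inj₂ refl) = shifts-next-side r (shifts-next-side r shifts)

  shifts-σ : ∀ r s → Shifts r s → Shifts r (σ s)
  shifts-σ r s shifts =
    trans (cong col (σ-head s)) (trans shifts (cong (rotate r ∘ col) (sym (σ-tail s))))

  shifts-adjacent : ∀ r {f g} → FaceAdj vert σ f g → FaceShifts r f → FaceShifts r g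
  shifts-adjacent r {f} (i , j , σfi≡gj) shifts =
    shifts-face r (subst (Shifts r) σfi≡gj (shifts-σ r (f , i) (shifts i)))

  shifts-everywhere : ∀ r {s} → Shifts r s → ∀ s′ → Shifts r s′
  shifts-everywhere r {f , i} shifts (g , j) =
    fold (λ f g → FaceShifts r f → FaceShifts r g)
         (λ adj rest → rest ∘ shifts-adjacent r adj) id
         (connected f g) (shifts-face r shifts) j

  global-rotation : Fin nV → ∃ λ r → ∀ s → Shifts r s
  global-rotation v with vert-surj v
  ... | c , _ with rotation-between (proper c)
  ...   | r , shifts = r , shifts-everywhere r shifts

  walk-colour : ∀ r {v w m} → (∀ s → Shifts r s) → Walk v w m → col w ≡ rotateⁿ r m (col v)
  walk-colour r           shifts []      = refl
  walk-colour r {m = suc m} shifts (s ∷ p) =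
    trans (walk-colour r shifts p) (cong (rotateⁿ r m) (shifts s))

  walk-same-colour⇔3∣ : ∀ {v w m} → Walk v w m → (col v ≡ col w) ⇔ (3 ∣ m)
  walk-same-colour⇔3∣ {v} {m = m} p with global-rotation v
  ... | r , shifts = mk⇔
    (λ v≡w → to (trans (sym (walk-colour r shifts p)) (sym v≡w)))
    (λ 3∣m → sym (trans (walk-colour r shifts p) (from 3∣m)))
    where open Equivalence (rotateⁿ-fixes⇔3∣ r m (col v))

lemma1 : ∀ {nV nF} (Γ₀ : DirEulerMultiTriangulation nV nF) (col : Fin nV → Fin 3) →
         DirEulerMultiTriangulation.ProperColouring Γ₀ col →
         (∀ v w m → DirEulerMultiTriangulation.Walk Γ₀ v w m → ((col v ≡ col w) ⇔ (3 ∣ m)))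
         × (∀ v m → DirEulerMultiTriangulation.Walk Γ₀ v v m → 3 ∣ m)
lemma1 Γ₀ col proper =
    (λ v w m → walk-same-colour⇔3∣ Γ₀ col proper)
  , (λ v m p → Equivalence.to (walk-same-colour⇔3∣ Γ₀ col proper p) refl)
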